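{- If $T$ is a tree with $\Delta(T)\geq 2$, then $$\rho_o(T)+1\leq L_{2,t}(T)\leq 2\rho_o(T).$$ Moreover: (i) $\rho_o(T)+1=L_{2,t}(T)$ if and only if $T$ is a star with at least three vertices; (ii) $L_{2,t}(T)=2\rho_o(T)$ if and only if for every $L_{2,t}(T)$-set $S$ and every $\gamma_t(T)$-set $D$ we have $|N(s)\cap D|=1$ for every $s\in S$ and $|N(d)\cap S|=2$ for every $d\in D$.
   Context: $N(v)$ denotes the open neighborhood of $v$ and $\Delta(T)$ the maximum degree. An open packing is a set $B$ with $|B\cap N(v)|\leq 1$ for all vertices $v$; $\rho_o(T)$ is the maximum size of an open packing. A set $B$ is a $2$-total limited packing set if $|B\cap N(v)|\leq 2$ for all vertices $v$; $L_{2,t}(T)$ is the maximum size of such a set, and an $L_{2,t}(T)$-set is such a set of size $L_{2,t}(T)$. A total dominating set is a set $D$ such that every vertex has a neighbor in $D$; $\gamma_t(T)$ is the minimum size of such a set, and a $\gamma_t(T)$-set is a total dominating set of size $\gamma_t(T)$. -}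

module Defs where

open import Data.Nat using (ℕ; _≤_; _+_; _*_)
open import Data.Bool using (Bool; true)
open import Data.Fin using (Fin)
open import Data.Fin.Subset using (Subset; _∩_; ∣_∣; _∈_)
open import Data.Vec using (tabulate)
open import Data.List using (List; []; _∷_; _∷ʳ_; length)
open import Data.List.Relation.Unary.Linked using (Linked)
open import Data.List.Relation.Unary.Unique.Propositional using (Unique)
open import Data.Product using (Σ; ∃; ∃-syntax; _×_)
open import Data.Sum using (_⊎_)
open import Data.Empty using (⊥)
open import Relation.Binary.PropositionalEquality using (_≡_; _≢_)
open import Relation.Nullary using (¬_)

record Graph : Set where
  field
    n      : ℕ
    adj    : Fin n → Fin n → Bool
    adj-sym    : ∀ u v → adj u v ≡ adj v u
    adj-irrefl : ∀ v → ¬ (adj v v ≡ true)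
open Graph public

module _ (G : Graph) where

  Adj : Fin (n G) → Fin (n G) → Set
  Adj u v = adj G u v ≡ true

  N : Fin (n G) → Subset (n G)
  N v = tabulate (adj G v)

  deg : Fin (n G) → ℕ
  deg v = ∣ N v ∣

  MaxDegree≥ : ℕ → Set
  MaxDegree≥ k = ∃[ v ] (k ≤ deg v)

  data Reach : Fin (n G) → Fin (n G) → Set where
    here : ∀ {u} → Reach u u
    step : ∀ {u v w} → Adj u v → Reach v w → Reach u w

  Connected : Set
  Connected = ∀ u v → Reach u v

  HasCycle : Set
  HasCycle = ∃[ x ] ∃[ ys ] (2 ≤ length ys × Unique (x ∷ ys) × Linked Adj (x ∷ ys ∷ʳ x))

  Acyclic : Set
  Acyclic = ¬ HasCycle

  IsTree : Set
  IsTree = Connected × Acyclic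

  IsStar≥3 : Set
  IsStar≥3 = 3 ≤ n G × ∃[ c ] ((∀ v → v ≢ c → Adj c v) × (∀ u v → Adj u v → u ≡ c ⊎ v ≡ c))

  IsOpenPacking : Subset (n G) → Set
  IsOpenPacking B = ∀ v → ∣ B ∩ N v ∣ ≤ 1

  Is2TotalLimitedPacking : Subset (n G) → Set
  Is2TotalLimitedPacking B = ∀ v → ∣ B ∩ N v ∣ ≤ 2

  IsTotalDominating : Subset (n G) → Set
  IsTotalDominating D = ∀ v → ∃[ u ] (u ∈ D × Adj v u)

  IsMaxSize : (Subset (n G) → Set) → ℕ → Set
  IsMaxSize P k = (∃[ B ] (P B × ∣ B ∣ ≡ k)) × (∀ B → P B → ∣ B ∣ ≤ k)

  IsMinSize : (Subset (n G) → Set) → ℕ → Set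
  IsMinSize P k = (∃[ B ] (P B × ∣ B ∣ ≡ k)) × (∀ B → P B → k ≤ ∣ B ∣)

  ρo≡ : ℕ → Set
  ρo≡ = IsMaxSize IsOpenPacking

  L2t≡ : ℕ → Set
  L2t≡ = IsMaxSize Is2TotalLimitedPacking

  γt≡ : ℕ → Set
  γt≡ = IsMinSize IsTotalDominating

  IsL2tSet : Subset (n G) → Set
  IsL2tSet S = Is2TotalLimitedPacking S × L2t≡ ∣ S ∣

  IsγtSet : Subset (n G) → Set
  IsγtSet D = IsTotalDominating D × γt≡ ∣ D ∣

{-# OPTIONS --safe #-}
module Submission where

-- Double counting the edges between a set X with |X ∩ N(v)| ≤ k for every v and a total
-- dominating set D gives |X| ≤ k |D|, with equality exactly when every vertex of X has one
-- neighbour in D and every vertex of D has k neighbours in X. In a tree, Rall's greedy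
-- argument (put a deepest undominated vertex into a packing and its parent into a dominating
-- set) yields a total dominating set no larger than an open packing, so γt = ρo. Hence
-- L₂,t ≤ 2γt = 2ρo, and (ii) is the equality case of the double count.
--
-- A maximum open packing B together with any open packing disjoint from it is a 2-total
-- limited packing. As Δ ≥ 2, some vertex lies outside B, so ρo + 1 ≤ L₂,t. On a path a b c d,
-- B misses one of a, c and one of b, d; these lie on opposite sides of the bipartition, so they
-- have no common neighbour and ρo + 2 ≤ L₂,t. Equality ρo + 1 = L₂,t therefore forbids such
-- paths, which makes T a star; conversely, in a star L₂,t ≤ 3 and ρo ≥ 2.

open import Defs
open import Data.Bool using (Bool; true; false; _∧_; not; if_then_else_)
open import Data.Bool.Properties using (∧-zeroʳ; not-involutive; not-¬) renaming (_≟_ to _≟ᵇ_)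
open import Data.Fin using (Fin; zero; suc) renaming (_≟_ to _≟ᶠ_)
open import Data.Fin.Properties using (any?)
open import Data.Fin.Subset
  using (Subset; _∩_; _∪_; _─_; ⁅_⁆; ⊥; ⊤; ∣_∣; _∈_; _∉_; _⊆_; Nonempty; Empty; inside; outside)
open import Data.Fin.Subset.Properties
open import Data.List using (List; []; _∷_; _∷ʳ_; length)
open import Data.List.Properties using (length-++)
open import Data.List.Relation.Unary.All as All using (All; []; _∷_)
open import Data.List.Relation.Unary.All.Properties using (∷ʳ⁺)
open import Data.List.Relation.Unary.AllPairs using ([]; _∷_)
import Data.List.Relation.Unary.AllPairs.Properties as AllPairs
open import Data.List.Relation.Unary.Linked using (Linked; []; [-]; _∷_)
open import Data.List.Relation.Unary.Unique.Propositional using (Unique)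
open import Data.Nat using (ℕ; zero; suc; _≤_; _<_; _+_; _*_; z≤n; s≤s)
open import Data.Nat.Induction using (<-wellFounded)
open import Data.Nat.Properties
open import Data.Product using (∃-syntax; _×_; _,_; proj₁; proj₂)
open import Data.Sum as Sum using (_⊎_; inj₁; inj₂; [_,_]′)
open import Data.Vec using ([]; _∷_; lookup; here; there)
open import Data.Vec.Properties using (lookup∘tabulate; lookup-zipWith; []=⇒lookup; lookup⇒[]=)
open import Function using (id)
open import Function.Bundles using (_⇔_; mk⇔; Equivalence)
open import Induction.WellFounded using (Acc; acc)
open import Relation.Binary.Definitions using (tri<; tri≈; tri>)
open import Relation.Binary.PropositionalEquality
open import Relation.Nullary using (¬_; yes; no; contradiction)
open import Relation.Nullary.Decidable using (_×-dec_; ¬?; decidable-stable)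
open import Relation.Unary using (Decidable)

open import Algebra.Properties.Semiring.Sum +-*-semiring
  using (sum-syntax; ∑-comm; sum-cong-≗; sum-replicate-zero)

-- Sums and cardinalities over subsets

∑∈ : ∀ {n} → Subset n → (Fin n → ℕ) → ℕ
∑∈ {n} X f = ∑[ x < n ] (if lookup X x then f x else 0)

syntax ∑∈ X (λ x → e) = ∑[ x ∈ X ] e

∑∈-const : ∀ {n} (X : Subset n) k → ∑[ _ ∈ X ] k ≡ k * ∣ X ∣
∑∈-const []            k = sym (*-zeroʳ k)
∑∈-const (outside ∷ X) k = ∑∈-const X k
∑∈-const (inside ∷ X)  k = trans (cong (k +_) (∑∈-const X k)) (sym (*-suc k ∣ X ∣))

∣p∣≡∑∈p1 : ∀ {n} (p : Subset n) → ∣ p ∣ ≡ ∑[ _ ∈ p ] 1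
∣p∣≡∑∈p1 p = sym (trans (∑∈-const p 1) (*-identityˡ ∣ p ∣))

∑∈-mono : ∀ {n} (X : Subset n) {f g : Fin n → ℕ} → (∀ {x} → x ∈ X → f x ≤ g x) →
          ∑[ x ∈ X ] f x ≤ ∑[ x ∈ X ] g x
∑∈-mono []            f≤g = z≤n
∑∈-mono (outside ∷ X) f≤g = ∑∈-mono X (λ x∈X → f≤g (there x∈X))
∑∈-mono (inside ∷ X)  f≤g = +-mono-≤ (f≤g here) (∑∈-mono X (λ x∈X → f≤g (there x∈X)))

∑∈-cong : ∀ {n} (X : Subset n) {f g : Fin n → ℕ} → (∀ {x} → x ∈ X → f x ≡ g x) →
          ∑[ x ∈ X ] f x ≡ ∑[ x ∈ X ] g x
∑∈-cong X f≡g = ≤-antisym (∑∈-mono X (λ x∈X → ≤-reflexive (f≡g x∈X)))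
                          (∑∈-mono X (λ x∈X → ≤-reflexive (sym (f≡g x∈X))))

private
  +-rigid : ∀ {a b c d} → a ≤ b → c ≤ d → b + d ≤ a + c → a ≡ b × d ≤ c
  +-rigid {a} {b} {c} {d} a≤b c≤d b+d≤a+c =
    ≤-antisym a≤b (+-cancelʳ-≤ d b a (≤-trans b+d≤a+c (+-monoʳ-≤ a c≤d))) ,
    +-cancelˡ-≤ b d c (≤-trans b+d≤a+c (+-monoˡ-≤ c a≤b))

∑∈-rigid : ∀ {n} (X : Subset n) {f g : Fin n → ℕ} → (∀ {x} → x ∈ X → f x ≤ g x) →
           ∑[ x ∈ X ] g x ≤ ∑[ x ∈ X ] f x → ∀ {x} → x ∈ X → f x ≡ g x
∑∈-rigid (outside ∷ X) f≤g Σg≤Σf (there x∈X) = ∑∈-rigid X (λ y∈X → f≤g (there y∈X)) Σg≤Σf x∈X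
∑∈-rigid (inside ∷ X) {f} {g} f≤g Σg≤Σf x∈X = go x∈X
  where
  tail≤ : ∀ {x} → x ∈ X → f (suc x) ≤ g (suc x)
  tail≤ x∈X = f≤g (there x∈X)
  split : f zero ≡ g zero × ∑[ x ∈ X ] g (suc x) ≤ ∑[ x ∈ X ] f (suc x)
  split = +-rigid (f≤g here) (∑∈-mono X tail≤) Σg≤Σf
  go : ∀ {x} → x ∈ inside ∷ X → f x ≡ g x
  go here        = proj₁ split
  go (there x∈X) = ∑∈-rigid X tail≤ (proj₂ split) x∈X

∣p∪q∣+∣p∩q∣≡∣p∣+∣q∣ : ∀ {n} (p q : Subset n) → ∣ p ∪ q ∣ + ∣ p ∩ q ∣ ≡ ∣ p ∣ + ∣ q ∣
∣p∪q∣+∣p∩q∣≡∣p∣+∣q∣ []            []            = refl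
∣p∪q∣+∣p∩q∣≡∣p∣+∣q∣ (outside ∷ p) (outside ∷ q) = ∣p∪q∣+∣p∩q∣≡∣p∣+∣q∣ p q
∣p∪q∣+∣p∩q∣≡∣p∣+∣q∣ (inside ∷ p)  (outside ∷ q) = cong suc (∣p∪q∣+∣p∩q∣≡∣p∣+∣q∣ p q)
∣p∪q∣+∣p∩q∣≡∣p∣+∣q∣ (outside ∷ p) (inside ∷ q)  =
  trans (cong suc (∣p∪q∣+∣p∩q∣≡∣p∣+∣q∣ p q)) (sym (+-suc ∣ p ∣ ∣ q ∣))
∣p∪q∣+∣p∩q∣≡∣p∣+∣q∣ (inside ∷ p)  (inside ∷ q)  =
  cong suc (trans (+-suc ∣ p ∪ q ∣ ∣ p ∩ q ∣)
                  (trans (cong suc (∣p∪q∣+∣p∩q∣≡∣p∣+∣q∣ p q)) (sym (+-suc ∣ p ∣ ∣ q ∣))))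

∣p∪q∣≤∣p∣+∣q∣ : ∀ {n} (p q : Subset n) → ∣ p ∪ q ∣ ≤ ∣ p ∣ + ∣ q ∣
∣p∪q∣≤∣p∣+∣q∣ p q = subst (∣ p ∪ q ∣ ≤_) (∣p∪q∣+∣p∩q∣≡∣p∣+∣q∣ p q) (m≤m+n ∣ p ∪ q ∣ ∣ p ∩ q ∣)

Empty[p∩q]⇒∣p∪q∣≡∣p∣+∣q∣ : ∀ {n} (p q : Subset n) → Empty (p ∩ q) → ∣ p ∪ q ∣ ≡ ∣ p ∣ + ∣ q ∣
Empty[p∩q]⇒∣p∪q∣≡∣p∣+∣q∣ {n} p q empty = begin
  ∣ p ∪ q ∣              ≡⟨ +-identityʳ _ ⟨
  ∣ p ∪ q ∣ + 0          ≡⟨ cong (∣ p ∪ q ∣ +_) ∣p∩q∣≡0 ⟨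
  ∣ p ∪ q ∣ + ∣ p ∩ q ∣  ≡⟨ ∣p∪q∣+∣p∩q∣≡∣p∣+∣q∣ p q ⟩
  ∣ p ∣ + ∣ q ∣          ∎
  where
  open ≡-Reasoning
  ∣p∩q∣≡0 : ∣ p ∩ q ∣ ≡ 0
  ∣p∩q∣≡0 = trans (cong ∣_∣ (Empty-unique empty)) (∣⊥∣≡0 n)

x∈⁅y⁆∪⁅z⁆⁻ : ∀ {n} {x y z : Fin n} → x ∈ ⁅ y ⁆ ∪ ⁅ z ⁆ → x ≡ y ⊎ x ≡ z
x∈⁅y⁆∪⁅z⁆⁻ {y = y} {z} x∈ = Sum.map (x∈⁅y⁆⇒x≡y y) (x∈⁅y⁆⇒x≡y z) (x∈p∪q⁻ ⁅ y ⁆ ⁅ z ⁆ x∈)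

∣⁅x⁆∪⁅y⁆∣≡2 : ∀ {n} {x y : Fin n} → x ≢ y → ∣ ⁅ x ⁆ ∪ ⁅ y ⁆ ∣ ≡ 2
∣⁅x⁆∪⁅y⁆∣≡2 {x = x} {y} x≢y =
  trans (Empty[p∩q]⇒∣p∪q∣≡∣p∣+∣q∣ ⁅ x ⁆ ⁅ y ⁆ disjoint) (cong₂ _+_ (∣⁅x⁆∣≡1 x) (∣⁅x⁆∣≡1 y))
  where
  disjoint : Empty (⁅ x ⁆ ∩ ⁅ y ⁆)
  disjoint (z , z∈) with x∈p∩q⁻ ⁅ x ⁆ ⁅ y ⁆ z∈
  ... | z∈⁅x⁆ , z∈⁅y⁆ = x≢y (trans (sym (x∈⁅y⁆⇒x≡y x z∈⁅x⁆)) (x∈⁅y⁆⇒x≡y y z∈⁅y⁆))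

x∈p─q⇒x∉q : ∀ {n} {p q : Subset n} {x} → x ∈ p ─ q → x ∉ q
x∈p─q⇒x∉q {p = _ ∷ _} {_ ∷ _} (there x∈p─q) (there x∈q) = x∈p─q⇒x∉q x∈p─q x∈q

module _ {n} {p : Subset n} where

  x∈p⇒0<∣p∣ : ∀ {x} → x ∈ p → 0 < ∣ p ∣
  x∈p⇒0<∣p∣ {x} x∈p = subst (_≤ ∣ p ∣) (∣⁅x⁆∣≡1 x) (p⊆q⇒∣p∣≤∣q∣ ⁅x⁆⊆p)
    where
    ⁅x⁆⊆p : ⁅ x ⁆ ⊆ p
    ⁅x⁆⊆p y∈⁅x⁆ = subst (_∈ p) (sym (x∈⁅y⁆⇒x≡y x y∈⁅x⁆)) x∈p

  x≢y∈p⇒1<∣p∣ : ∀ {x y} → x ∈ p → y ∈ p → x ≢ y → 1 < ∣ p ∣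
  x≢y∈p⇒1<∣p∣ {x} {y} x∈p y∈p x≢y =
    subst (_≤ ∣ p ∣) (∣⁅x⁆∪⁅y⁆∣≡2 x≢y) (p⊆q⇒∣p∣≤∣q∣ ⁅x⁆∪⁅y⁆⊆p)
    where
    ⁅x⁆∪⁅y⁆⊆p : ⁅ x ⁆ ∪ ⁅ y ⁆ ⊆ p
    ⁅x⁆∪⁅y⁆⊆p z∈ with x∈⁅y⁆∪⁅z⁆⁻ z∈
    ... | inj₁ refl = x∈p
    ... | inj₂ refl = y∈p

  ∈-unique⇒∣p∣≤1 : (∀ {x y} → x ∈ p → y ∈ p → x ≡ y) → ∣ p ∣ ≤ 1
  ∈-unique⇒∣p∣≤1 unique with nonempty? p
  ... | no empty = ≤-trans (≤-reflexive (trans (cong ∣_∣ (Empty-unique empty)) (∣⊥∣≡0 n))) z≤n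
  ... | yes (x , x∈p) = subst (∣ p ∣ ≤_) (∣⁅x⁆∣≡1 x) (p⊆q⇒∣p∣≤∣q∣ p⊆⁅x⁆)
    where
    p⊆⁅x⁆ : p ⊆ ⁅ x ⁆
    p⊆⁅x⁆ y∈p = subst (_∈ ⁅ x ⁆) (unique x∈p y∈p) (x∈⁅x⁆ x)

  ∣p∣≤1⇒∈-unique : ∣ p ∣ ≤ 1 → ∀ {x y} → x ∈ p → y ∈ p → x ≡ y
  ∣p∣≤1⇒∈-unique ∣p∣≤1 {x} {y} x∈p y∈p with x ≟ᶠ y
  ... | yes x≡y = x≡y
  ... | no x≢y  = contradiction ∣p∣≤1 (<⇒≱ (x≢y∈p⇒1<∣p∣ x∈p y∈p x≢y))

  1<∣p∣⇒∃≢ : 1 < ∣ p ∣ → ∀ x → ∃[ y ] (y ∈ p × y ≢ x)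
  1<∣p∣⇒∃≢ 1<∣p∣ x with any? (λ y → (y ∈? p) ×-dec ¬? (y ≟ᶠ x))
  ... | yes found = found
  ... | no none =
    contradiction (∈-unique⇒∣p∣≤1 (λ y∈p z∈p → trans (only y∈p) (sym (only z∈p)))) (<⇒≱ 1<∣p∣)
    where
    only : ∀ {y} → y ∈ p → y ≡ x
    only {y} y∈p = decidable-stable (y ≟ᶠ x) (λ y≢x → none (y , y∈p , y≢x))

argmax : ∀ {n} (f : Fin n → ℕ) {p : Subset n} → Nonempty p →
         ∃[ w ] (w ∈ p × ∀ {x} → x ∈ p → f x ≤ f w)
argmax f {outside ∷ p} (suc x , there x∈p) with argmax (λ i → f (suc i)) (x , x∈p)
... | w , w∈p , max = suc w , there w∈p , λ { (there y∈p) → max y∈p }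
argmax f {inside ∷ p} _ with nonempty? p
... | no empty = zero , here , λ { here → ≤-refl ; (there y∈p) → contradiction (_ , y∈p) empty }
... | yes nonempty with argmax (λ i → f (suc i)) nonempty
...   | w , w∈p , max with f zero ≤? f (suc w)
...     | yes f0≤fw = suc w , there w∈p , λ { here → f0≤fw ; (there y∈p) → max y∈p }
...     | no f0≰fw  =
  zero , here , λ { here → ≤-refl ; (there y∈p) → ≤-trans (max y∈p) (<⇒≤ (≰⇒> f0≰fw)) }

-- Packings, total domination and double counting

module _ (G : Graph) where

  Adj⇒≢ : ∀ {x y} → Adj G x y → x ≢ y
  Adj⇒≢ xy refl = adj-irrefl G _ xy

  Adj-sym : ∀ {x y} → Adj G x y → Adj G y x
  Adj-sym {x} {y} xy = trans (adj-sym G y x) xy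

  x∈N⇒Adj : ∀ {v x} → x ∈ N G v → Adj G v x
  x∈N⇒Adj {v} {x} x∈N = trans (sym (lookup∘tabulate (adj G v) x)) ([]=⇒lookup x∈N)

  Adj⇒x∈N : ∀ {v x} → Adj G v x → x ∈ N G v
  Adj⇒x∈N {v} {x} vx = lookup⇒[]= x (N G v) (trans (lookup∘tabulate (adj G v) x) vx)

  double-counting : ∀ (X Y : Subset (n G)) → ∑[ x ∈ X ] ∣ N G x ∩ Y ∣ ≡ ∑[ y ∈ Y ] ∣ N G y ∩ X ∣
  double-counting X Y = begin
    ∑[ x ∈ X ] ∣ N G x ∩ Y ∣                  ≡⟨ ∑∈∣N∩∣≡edges X Y ⟩
    ∑[ x < n G ] ∑[ y < n G ] edge X Y x y    ≡⟨ ∑-comm (edge X Y) ⟩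
    ∑[ y < n G ] ∑[ x < n G ] edge X Y x y    ≡⟨ sum-cong-≗ (λ y → sum-cong-≗ (λ x → edge-sym x y)) ⟩
    ∑[ y < n G ] ∑[ x < n G ] edge Y X y x    ≡⟨ ∑∈∣N∩∣≡edges Y X ⟨
    ∑[ y ∈ Y ] ∣ N G y ∩ X ∣                  ∎
    where
    open ≡-Reasoning
    indicator : Bool → ℕ
    indicator b = if b then 1 else 0
    edge : Subset (n G) → Subset (n G) → Fin (n G) → Fin (n G) → ℕ
    edge A C a c = indicator (lookup A a ∧ (adj G a c ∧ lookup C c))
    ∣N∩∣≡∑ : ∀ a (C : Subset (n G)) → ∣ N G a ∩ C ∣ ≡ ∑[ c < n G ] indicator (adj G a c ∧ lookup C c)
    ∣N∩∣≡∑ a C = trans (∣p∣≡∑∈p1 (N G a ∩ C)) (sum-cong-≗ λ c → cong indicator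
      (trans (lookup-zipWith _∧_ c (N G a) C) (cong (_∧ lookup C c) (lookup∘tabulate (adj G a) c))))
    ∑∈∣N∩∣≡edges : ∀ A C → ∑[ a ∈ A ] ∣ N G a ∩ C ∣ ≡ ∑[ a < n G ] ∑[ c < n G ] edge A C a c
    ∑∈∣N∩∣≡edges A C = sum-cong-≗ row
      where
      row : ∀ a → (if lookup A a then ∣ N G a ∩ C ∣ else 0) ≡ ∑[ c < n G ] edge A C a c
      row a with lookup A a
      ... | true  = ∣N∩∣≡∑ a C
      ... | false = sym (sum-replicate-zero (n G))
    ∧-rotate : ∀ a b c → a ∧ (b ∧ c) ≡ c ∧ (b ∧ a)
    ∧-rotate true  b true  = refl
    ∧-rotate true  b false = ∧-zeroʳ b
    ∧-rotate false b true  = sym (∧-zeroʳ b)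
    ∧-rotate false b false = refl
    edge-sym : ∀ x y → edge X Y x y ≡ edge Y X y x
    edge-sym x y = cong indicator (trans (∧-rotate (lookup X x) (adj G x y) (lookup Y y))
                                         (cong (λ b → lookup Y y ∧ (b ∧ lookup X x)) (adj-sym G x y)))

  module _ {k} {X D : Subset (n G)} (X-limited : ∀ v → ∣ X ∩ N G v ∣ ≤ k)
           (D-total : IsTotalDominating G D) where

    private
      dominated : ∀ {x} → x ∈ X → 1 ≤ ∣ N G x ∩ D ∣
      dominated {x} _ with D-total x
      ... | u , u∈D , xu = x∈p⇒0<∣p∣ (x∈p∩q⁺ (Adj⇒x∈N xu , u∈D))

      limited : ∀ {d} → d ∈ D → ∣ N G d ∩ X ∣ ≤ k
      limited {d} _ = subst (_≤ k) (cong ∣_∣ (∩-comm X (N G d))) (X-limited d)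

      ∣X∣≤∑ : ∣ X ∣ ≤ ∑[ x ∈ X ] ∣ N G x ∩ D ∣
      ∣X∣≤∑ = subst (_≤ ∑[ x ∈ X ] ∣ N G x ∩ D ∣) (sym (∣p∣≡∑∈p1 X)) (∑∈-mono X dominated)

      ∑≤k∣D∣ : ∑[ d ∈ D ] ∣ N G d ∩ X ∣ ≤ k * ∣ D ∣
      ∑≤k∣D∣ = subst (∑[ d ∈ D ] ∣ N G d ∩ X ∣ ≤_) (∑∈-const D k) (∑∈-mono D limited)

    ∣X∣≤k*∣D∣ : ∣ X ∣ ≤ k * ∣ D ∣
    ∣X∣≤k*∣D∣ = begin
      ∣ X ∣                      ≤⟨ ∣X∣≤∑ ⟩
      ∑[ x ∈ X ] ∣ N G x ∩ D ∣   ≡⟨ double-counting X D ⟩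
      ∑[ d ∈ D ] ∣ N G d ∩ X ∣   ≤⟨ ∑≤k∣D∣ ⟩
      k * ∣ D ∣                  ∎
      where open ≤-Reasoning

    k*∣D∣≤∣X∣⇒tight : k * ∣ D ∣ ≤ ∣ X ∣ →
      (∀ {x} → x ∈ X → ∣ N G x ∩ D ∣ ≡ 1) × (∀ {d} → d ∈ D → ∣ N G d ∩ X ∣ ≡ k)
    k*∣D∣≤∣X∣⇒tight k∣D∣≤∣X∣ =
      (λ x∈X → sym (∑∈-rigid X dominated ∑X≤∣X∣ x∈X)) ,
      ∑∈-rigid D limited k∣D∣≤∑D
      where
      open ≤-Reasoning
      ∑X≤∣X∣ : ∑[ x ∈ X ] ∣ N G x ∩ D ∣ ≤ ∑[ _ ∈ X ] 1
      ∑X≤∣X∣ = begin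
        ∑[ x ∈ X ] ∣ N G x ∩ D ∣   ≡⟨ double-counting X D ⟩
        ∑[ d ∈ D ] ∣ N G d ∩ X ∣   ≤⟨ ∑≤k∣D∣ ⟩
        k * ∣ D ∣                  ≤⟨ k∣D∣≤∣X∣ ⟩
        ∣ X ∣                      ≡⟨ ∣p∣≡∑∈p1 X ⟩
        ∑[ _ ∈ X ] 1               ∎
      k∣D∣≤∑D : ∑[ _ ∈ D ] k ≤ ∑[ d ∈ D ] ∣ N G d ∩ X ∣
      k∣D∣≤∑D = begin
        ∑[ _ ∈ D ] k               ≡⟨ ∑∈-const D k ⟩
        k * ∣ D ∣                  ≤⟨ k∣D∣≤∣X∣ ⟩
        ∣ X ∣                      ≤⟨ ∣X∣≤∑ ⟩
        ∑[ x ∈ X ] ∣ N G x ∩ D ∣   ≡⟨ double-counting X D ⟩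
        ∑[ d ∈ D ] ∣ N G d ∩ X ∣   ∎

  SharesNeighbour : Fin (n G) → Fin (n G) → Set
  SharesNeighbour x y = ∃[ v ] (Adj G v x × Adj G v y)

  OpenNeighbourhoodsDisjoint : Subset (n G) → Set
  OpenNeighbourhoodsDisjoint B = ∀ {x y} → x ∈ B → y ∈ B → SharesNeighbour x y → x ≡ y

  open-packing⇔disjoint-neighbourhoods : ∀ {B} → IsOpenPacking G B ⇔ OpenNeighbourhoodsDisjoint B
  open-packing⇔disjoint-neighbourhoods {B} = mk⇔ to from
    where
    to : IsOpenPacking G B → OpenNeighbourhoodsDisjoint B
    to packing x∈B y∈B (v , vx , vy) =
      ∣p∣≤1⇒∈-unique (packing v) (x∈p∩q⁺ (x∈B , Adj⇒x∈N vx)) (x∈p∩q⁺ (y∈B , Adj⇒x∈N vy))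
    from : OpenNeighbourhoodsDisjoint B → IsOpenPacking G B
    from disjoint v = ∈-unique⇒∣p∣≤1 unique
      where
      unique : ∀ {x y} → x ∈ B ∩ N G v → y ∈ B ∩ N G v → x ≡ y
      unique x∈ y∈ with x∈p∩q⁻ B (N G v) x∈ | x∈p∩q⁻ B (N G v) y∈
      ... | x∈B , x∈Nv | y∈B , y∈Nv = disjoint x∈B y∈B (v , x∈N⇒Adj x∈Nv , x∈N⇒Adj y∈Nv)

  ∣B∣≤1⇒open-packing : ∀ {B} → ∣ B ∣ ≤ 1 → IsOpenPacking G B
  ∣B∣≤1⇒open-packing {B} ∣B∣≤1 v = ≤-trans (∣p∩q∣≤∣p∣ B (N G v)) ∣B∣≤1

  ∪-open-packing : ∀ {B E} → IsOpenPacking G B → IsOpenPacking G E → Is2TotalLimitedPacking G (B ∪ E)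
  ∪-open-packing {B} {E} B-packing E-packing v = begin
    ∣ (B ∪ E) ∩ N G v ∣               ≡⟨ cong ∣_∣ (∩-distribʳ-∪ (N G v) B E) ⟩
    ∣ (B ∩ N G v) ∪ (E ∩ N G v) ∣     ≤⟨ ∣p∪q∣≤∣p∣+∣q∣ (B ∩ N G v) (E ∩ N G v) ⟩
    ∣ B ∩ N G v ∣ + ∣ E ∩ N G v ∣     ≤⟨ +-mono-≤ (B-packing v) (E-packing v) ⟩
    2                                 ∎
    where open ≤-Reasoning

  SharesNeighbour-sym : ∀ {x y} → SharesNeighbour x y → SharesNeighbour y x
  SharesNeighbour-sym (v , vx , vy) = v , vy , vx

  pair-open-packing : ∀ {x y} → ¬ SharesNeighbour x y → IsOpenPacking G (⁅ x ⁆ ∪ ⁅ y ⁆)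
  pair-open-packing {x} {y} unshared = Equivalence.from open-packing⇔disjoint-neighbourhoods disjoint
    where
    disjoint : OpenNeighbourhoodsDisjoint (⁅ x ⁆ ∪ ⁅ y ⁆)
    disjoint a∈ b∈ shared with x∈⁅y⁆∪⁅z⁆⁻ a∈ | x∈⁅y⁆∪⁅z⁆⁻ b∈
    ... | inj₁ refl | inj₁ refl = refl
    ... | inj₂ refl | inj₂ refl = refl
    ... | inj₁ refl | inj₂ refl = contradiction shared unshared
    ... | inj₂ refl | inj₁ refl = contradiction (SharesNeighbour-sym shared) unshared

  open-packing≤total-domination : ∀ {B D} → IsOpenPacking G B → IsTotalDominating G D → ∣ B ∣ ≤ ∣ D ∣
  open-packing≤total-domination {B} {D} B-packing D-total =
    subst (∣ B ∣ ≤_) (*-identityˡ ∣ D ∣) (∣X∣≤k*∣D∣ {X = B} B-packing D-total)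

  tight⇒∣X∣≡k*∣D∣ : ∀ {k X D} → (∀ {x} → x ∈ X → ∣ N G x ∩ D ∣ ≡ 1) →
                    (∀ {d} → d ∈ D → ∣ N G d ∩ X ∣ ≡ k) → ∣ X ∣ ≡ k * ∣ D ∣
  tight⇒∣X∣≡k*∣D∣ {k} {X} {D} X-tight D-tight = begin
    ∣ X ∣                      ≡⟨ ∣p∣≡∑∈p1 X ⟩
    ∑[ _ ∈ X ] 1               ≡⟨ ∑∈-cong X (λ x∈X → sym (X-tight x∈X)) ⟩
    ∑[ x ∈ X ] ∣ N G x ∩ D ∣   ≡⟨ double-counting X D ⟩
    ∑[ d ∈ D ] ∣ N G d ∩ X ∣   ≡⟨ ∑∈-cong D D-tight ⟩
    ∑[ _ ∈ D ] k               ≡⟨ ∑∈-const D k ⟩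
    k * ∣ D ∣                  ∎
    where open ≡-Reasoning

  IsMaxSize-unique : ∀ {P k k′} → IsMaxSize G P k → IsMaxSize G P k′ → k ≡ k′
  IsMaxSize-unique ((B , PB , ∣B∣≡k) , maxk) ((B′ , PB′ , ∣B′∣≡k′) , maxk′) =
    ≤-antisym (subst (_≤ _) ∣B∣≡k (maxk′ B PB)) (subst (_≤ _) ∣B′∣≡k′ (maxk B′ PB′))

  IsMinSize-unique : ∀ {P k k′} → IsMinSize G P k → IsMinSize G P k′ → k ≡ k′
  IsMinSize-unique ((B , PB , ∣B∣≡k) , mink) ((B′ , PB′ , ∣B′∣≡k′) , mink′) =
    ≤-antisym (subst (_ ≤_) ∣B′∣≡k′ (mink B′ PB′)) (subst (_ ≤_) ∣B∣≡k (mink′ B PB))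

module _ (G : Graph) where

  connected⇒no-isolated : Connected G → ∀ {a b} → Adj G a b → ∀ v → ∃[ u ] Adj G v u
  connected⇒no-isolated connected {a} {b} ab v with v ≟ᶠ a
  ... | yes refl = b , ab
  ... | no v≢a   = first-step (connected v a) v≢a
    where
    first-step : ∀ {x y} → Reach G x y → x ≢ y → ∃[ u ] Adj G x u
    first-step here         x≢x = contradiction refl x≢x
    first-step (step xu _)  _   = _ , xu

  NonBacktrackingWalk : Fin (n G) → Fin (n G) → Fin (n G) → Fin (n G) → Set
  NonBacktrackingWalk a b c d = Adj G a b × Adj G b c × Adj G c d × a ≢ c × b ≢ d

  no-walk₃⇒star : Connected G → ∀ {c} → 1 < ∣ N G c ∣ →
                  (∀ {a b d} → ¬ NonBacktrackingWalk a b c d) → IsStar≥3 G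
  no-walk₃⇒star connected {c} 1<deg no-walk = 3≤n , c , spoke , edge-at-centre
    where
    near : ∀ {b a} → Adj G c b → Adj G b a → a ≡ c
    near {b} {a} cb ba with a ≟ᶠ c
    ... | yes a≡c = a≡c
    ... | no a≢c with 1<∣p∣⇒∃≢ 1<deg b
    ...   | d , d∈Nc , d≢b =
      contradiction (Adj-sym G ba , Adj-sym G cb , x∈N⇒Adj G d∈Nc , a≢c , ≢-sym d≢b) no-walk

    within-one : ∀ {u v} → u ≡ c ⊎ Adj G c u → Reach G u v → v ≡ c ⊎ Adj G c v
    within-one near-u      here           = near-u
    within-one (inj₁ refl) (step uw rest) = within-one (inj₂ uw) rest
    within-one (inj₂ cu)   (step uw rest) = within-one (inj₁ (near cu uw)) rest

    spoke : ∀ v → v ≢ c → Adj G c v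
    spoke v v≢c with within-one (inj₁ refl) (connected c v)
    ... | inj₁ v≡c = contradiction v≡c v≢c
    ... | inj₂ cv  = cv

    edge-at-centre : ∀ u v → Adj G u v → u ≡ c ⊎ v ≡ c
    edge-at-centre u v uv with u ≟ᶠ c
    ... | yes u≡c = inj₁ u≡c
    ... | no u≢c  = inj₂ (near (spoke u u≢c) uv)

    c∉Nc : Empty (N G c ∩ ⁅ c ⁆)
    c∉Nc (x , x∈) with x∈p∩q⁻ (N G c) ⁅ c ⁆ x∈
    ... | x∈Nc , x∈⁅c⁆ = adj-irrefl G c (subst (Adj G c) (x∈⁅y⁆⇒x≡y c x∈⁅c⁆) (x∈N⇒Adj G x∈Nc))

    3≤n : 3 ≤ n G
    3≤n = begin
      3                        ≤⟨ s≤s 1<deg ⟩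
      suc ∣ N G c ∣            ≡⟨ +-comm 1 ∣ N G c ∣ ⟩
      ∣ N G c ∣ + 1            ≡⟨ cong (∣ N G c ∣ +_) (∣⁅x⁆∣≡1 c) ⟨
      ∣ N G c ∣ + ∣ ⁅ c ⁆ ∣    ≡⟨ Empty[p∩q]⇒∣p∪q∣≡∣p∣+∣q∣ (N G c) ⁅ c ⁆ c∉Nc ⟨
      ∣ N G c ∪ ⁅ c ⁆ ∣        ≤⟨ ∣p∣≤n (N G c ∪ ⁅ c ⁆) ⟩
      n G                      ∎
      where open ≤-Reasoning

  star⇒∣S∣≤3 : IsStar≥3 G → ∀ {S} → Is2TotalLimitedPacking G S → ∣ S ∣ ≤ 3
  star⇒∣S∣≤3 (_ , c , spoke , _) {S} S-limited = begin
    ∣ S ∣                          ≤⟨ p⊆q⇒∣p∣≤∣q∣ S⊆c∪Nc ⟩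
    ∣ ⁅ c ⁆ ∪ (S ∩ N G c) ∣        ≤⟨ ∣p∪q∣≤∣p∣+∣q∣ ⁅ c ⁆ (S ∩ N G c) ⟩
    ∣ ⁅ c ⁆ ∣ + ∣ S ∩ N G c ∣      ≤⟨ +-mono-≤ (≤-reflexive (∣⁅x⁆∣≡1 c)) (S-limited c) ⟩
    3                              ∎
    where
    open ≤-Reasoning
    S⊆c∪Nc : S ⊆ ⁅ c ⁆ ∪ (S ∩ N G c)
    S⊆c∪Nc {x} x∈S with x ≟ᶠ c
    ... | yes refl = x∈p∪q⁺ (inj₁ (x∈⁅x⁆ x))
    ... | no x≢c   = x∈p∪q⁺ (inj₂ (x∈p∩q⁺ (x∈S , Adj⇒x∈N G (spoke x x≢c))))

  star⇒open-packing-pair : IsStar≥3 G → ∃[ B ] (IsOpenPacking G B × ∣ B ∣ ≡ 2)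
  star⇒open-packing-pair (3≤n , c , _ , edge-at-centre) with 1<∣p∣⇒∃≢ {p = ⊤} 1<∣⊤∣ c
    where
    1<∣⊤∣ : 1 < ∣ ⊤ {n G} ∣
    1<∣⊤∣ = subst (1 <_) (sym (∣⊤∣≡n (n G))) (≤-trans (s≤s (s≤s z≤n)) 3≤n)
  ... | ℓ , _ , ℓ≢c = ⁅ c ⁆ ∪ ⁅ ℓ ⁆ , pair-open-packing G unshared , ∣⁅x⁆∪⁅y⁆∣≡2 (≢-sym ℓ≢c)
    where
    unshared : ¬ SharesNeighbour G c ℓ
    unshared (v , vc , vℓ) with edge-at-centre v ℓ vℓ
    ... | inj₁ refl = adj-irrefl G v vc
    ... | inj₂ ℓ≡c  = ℓ≢c ℓ≡c

-- Distances and rootings of trees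

minimal : ∀ {P : ℕ → Set} → Decidable P → ∀ {b} → P b → ∃[ m ] (P m × ∀ {k} → P k → m ≤ k)
minimal P? {zero} Pb = 0 , Pb , λ _ → z≤n
minimal {P} P? {suc b} Pb with P? 0
... | yes P0 = 0 , P0 , λ _ → z≤n
... | no ¬P0 with minimal {λ k → P (suc k)} (λ k → P? (suc k)) Pb
...   | m , Pm , least =
  suc m , Pm , λ { {zero} P0 → contradiction P0 ¬P0 ; {suc k} Pk → s≤s (least Pk) }

Linked-∷ʳ⁺ : ∀ {A : Set} {R : A → A → Set} xs {y z} →
             Linked R (xs ∷ʳ y) → R y z → Linked R (xs ∷ʳ y ∷ʳ z)
Linked-∷ʳ⁺ []           [-]           Ryz = Ryz ∷ [-]
Linked-∷ʳ⁺ (x ∷ [])     (Rxy ∷ [-])   Ryz = Rxy ∷ Ryz ∷ [-]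
Linked-∷ʳ⁺ (x ∷ w ∷ xs) (Rxw ∷ Rwxs)  Ryz = Rxw ∷ Linked-∷ʳ⁺ (w ∷ xs) Rwxs Ryz

Unique-∷-∷ʳ⁺ : ∀ {A : Set} {x z : A} {ys} → All (x ≢_) ys → All (z ≢_) ys → x ≢ z →
               Unique ys → Unique (x ∷ ys ∷ʳ z)
Unique-∷-∷ʳ⁺ x∉ys z∉ys x≢z ys! =
  ∷ʳ⁺ x∉ys x≢z ∷ AllPairs.++⁺ ys! ([] ∷ []) (All.map (λ z≢y → (λ y≡z → z≢y (sym y≡z)) ∷ []) z∉ys)

module Distance (G : Graph) (connected : Connected G) (r : Fin (n G)) where

  WalkToRoot : ℕ → Fin (n G) → Set
  WalkToRoot zero    v = v ≡ r
  WalkToRoot (suc k) v = ∃[ u ] (Adj G v u × WalkToRoot k u)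

  walkToRoot? : ∀ k → Decidable (WalkToRoot k)
  walkToRoot? zero    v = v ≟ᶠ r
  walkToRoot? (suc k) v = any? (λ u → (adj G v u ≟ᵇ true) ×-dec walkToRoot? k u)

  reach⇒walk : ∀ {v} → Reach G v r → ∃[ k ] WalkToRoot k v
  reach⇒walk here = 0 , refl
  reach⇒walk (step vu rest) with reach⇒walk rest
  ... | k , walk = suc k , _ , vu , walk

  shortest : ∀ v → ∃[ m ] (WalkToRoot m v × ∀ {k} → WalkToRoot k v → m ≤ k)
  shortest v = minimal (λ k → walkToRoot? k v) (proj₂ (reach⇒walk (connected v r)))

  dist : Fin (n G) → ℕ
  dist v = proj₁ (shortest v)

  dist≡0⇒root : ∀ {v} → dist v ≡ 0 → v ≡ r
  dist≡0⇒root {v} d≡0 = subst (λ k → WalkToRoot k v) d≡0 (proj₁ (proj₂ (shortest v)))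

  dist-adj : ∀ {x y} → Adj G x y → dist x ≤ suc (dist y)
  dist-adj {x} {y} xy = proj₂ (proj₂ (shortest x)) (y , xy , proj₁ (proj₂ (shortest y)))

  dist-suc⇒lower-neighbour : ∀ {v k} → dist v ≡ suc k → ∃[ u ] (Adj G v u × dist u ≡ k)
  dist-suc⇒lower-neighbour {v} {k} d≡1+k
    with subst (λ j → WalkToRoot j v) d≡1+k (proj₁ (proj₂ (shortest v)))
  ... | u , vu , walk = u , vu , ≤-antisym (proj₂ (proj₂ (shortest u)) walk)
                                          (≤-pred (subst (_≤ suc (dist u)) d≡1+k (dist-adj vu)))

record Rooting (G : Graph) : Set where
  field
    depth         : Fin (n G) → ℕ
    depth-adj     : ∀ {x y} → Adj G x y → depth y ≡ suc (depth x) ⊎ depth x ≡ suc (depth y)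
    parent-unique : ∀ {v y z} → Adj G v y → Adj G v z →
                    depth v ≡ suc (depth y) → depth v ≡ suc (depth z) → y ≡ z

module _ (G : Graph) (tree : IsTree G) (r : Fin (n G)) where

  open Distance G (proj₁ tree) r

  private
    acyclic : Acyclic G
    acyclic = proj₂ tree

    above⇒≢ : ∀ {j u ws} → dist u < j → All (λ w → j ≤ dist w) ws → All (u ≢_) ws
    above⇒≢ du<j = All.map (λ j≤dw u≡w → <⇒≱ du<j (subst (λ w → _ ≤ dist w) (sym u≡w) j≤dw))

  -- Extend the path by the parents of its two ends until these coincide, which must happen
  -- before the root is reached; the last extension then closes a cycle.
  level-path⇒cycle : ∀ k {y z} mid → y ≢ z → dist y ≡ k → dist z ≡ k → All (λ w → k ≤ dist w) mid →
                     Linked (Adj G) (y ∷ mid ∷ʳ z) → Unique (y ∷ mid ∷ʳ z) → HasCycle G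
  level-path⇒cycle zero _ y≢z dy dz _ _ _ =
    contradiction (trans (dist≡0⇒root dy) (sym (dist≡0⇒root dz))) y≢z
  level-path⇒cycle (suc k) {y} {z} mid _ dy dz mid-high linked unique =
    climb (dist-suc⇒lower-neighbour dy) (dist-suc⇒lower-neighbour dz)
    where
    path : List (Fin (n G))
    path = y ∷ mid ∷ʳ z
    high : All (λ w → suc k ≤ dist w) path
    high = ≤-reflexive (sym dy) ∷ ∷ʳ⁺ mid-high (≤-reflexive (sym dz))
    below⇒∉path : ∀ {u} → dist u ≡ k → All (u ≢_) path
    below⇒∉path du = above⇒≢ (s≤s (≤-reflexive du)) high
    climb : ∃[ u ] (Adj G y u × dist u ≡ k) → ∃[ u ] (Adj G z u × dist u ≡ k) → HasCycle G
    climb (y′ , yy′ , dy′) (z′ , zz′ , dz′) with y′ ≟ᶠ z′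
    ... | yes refl = y′ , path , 2≤length , below⇒∉path dy′ ∷ unique ,
                     Adj-sym G yy′ ∷ Linked-∷ʳ⁺ (y ∷ mid) linked zz′
      where
      2≤length : 2 ≤ length path
      2≤length = s≤s (subst (1 ≤_) (sym (length-++ mid)) (m≤n+m 1 (length mid)))
    ... | no y′≢z′ = level-path⇒cycle k path y′≢z′ dy′ dz′ (All.map <⇒≤ high)
                       (Adj-sym G yy′ ∷ Linked-∷ʳ⁺ (y ∷ mid) linked zz′)
                       (Unique-∷-∷ʳ⁺ (below⇒∉path dy′) (below⇒∉path dz′) y′≢z′ unique)

  tree-rooting : Rooting G
  tree-rooting = record { depth = dist ; depth-adj = depth-adj ; parent-unique = parent-unique }
    where
    depth-adj : ∀ {x y} → Adj G x y → dist y ≡ suc (dist x) ⊎ dist x ≡ suc (dist y)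
    depth-adj {x} {y} xy with <-cmp (dist x) (dist y)
    ... | tri< dx<dy _ _ = inj₁ (≤-antisym (dist-adj (Adj-sym G xy)) dx<dy)
    ... | tri> _ _ dy<dx = inj₂ (≤-antisym (dist-adj xy) dy<dx)
    ... | tri≈ _ dx≡dy _ = contradiction
      (level-path⇒cycle (dist x) [] x≢y refl (sym dx≡dy) [] (xy ∷ [-]) ((x≢y ∷ []) ∷ [] ∷ []))
      acyclic
      where
      x≢y : x ≢ y
      x≢y = Adj⇒≢ G xy

    parent-unique : ∀ {v y z} → Adj G v y → Adj G v z →
                    dist v ≡ suc (dist y) → dist v ≡ suc (dist z) → y ≡ z
    parent-unique {v} {y} {z} vy vz dv≡1+dy dv≡1+dz with y ≟ᶠ z
    ... | yes y≡z = y≡z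
    ... | no y≢z  = contradiction
      (level-path⇒cycle (dist y) (v ∷ []) y≢z refl dz≡dy (v-high ∷ []) (Adj-sym G vy ∷ vz ∷ [-]) unique)
      acyclic
      where
      dz≡dy : dist z ≡ dist y
      dz≡dy = suc-injective (trans (sym dv≡1+dz) dv≡1+dy)
      v-high : dist y ≤ dist v
      v-high = subst (dist y ≤_) (sym dv≡1+dy) (n≤1+n (dist y))
      unique : Unique (y ∷ v ∷ z ∷ [])
      unique = (Adj⇒≢ G (Adj-sym G vy) ∷ y≢z ∷ []) ∷ (Adj⇒≢ G vz ∷ []) ∷ [] ∷ []

odd : ℕ → Bool
odd zero    = false
odd (suc k) = not (odd k)

module _ {G : Graph} (R : Rooting G) where

  open Rooting R

  colour : Fin (n G) → Bool
  colour v = odd (depth v)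

  colour-adj : ∀ {x y} → Adj G x y → colour x ≡ not (colour y)
  colour-adj {x} xy with depth-adj xy
  ... | inj₁ dy≡1+dx = trans (sym (not-involutive (colour x))) (cong not (sym (cong odd dy≡1+dx)))
  ... | inj₂ dx≡1+dy = cong odd dx≡1+dy

  shared⇒same-colour : ∀ {x y} → SharesNeighbour G x y → colour x ≡ colour y
  shared⇒same-colour (v , vx , vy) = trans (colour-adj (Adj-sym G vx)) (sym (colour-adj (Adj-sym G vy)))

-- Rall's greedy construction

module Greedy (G : Graph) (R : Rooting G) (no-isolated : ∀ v → ∃[ u ] Adj G v u) where

  open Rooting R

  Dominates : Subset (n G) → Subset (n G) → Set
  Dominates D W = ∀ {w} → w ∈ W → ∃[ u ] (u ∈ D × Adj G w u)

  Children : Fin (n G) → Fin (n G) → Set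
  Children w u = ∀ {c} → Adj G w c → c ≢ u → depth c ≡ suc (depth w)

  Deepest : Subset (n G) → Fin (n G) → Set
  Deepest W w = ∀ {x} → x ∈ W → depth x ≤ depth w

  -- u is the parent of w, or any neighbour when w is the root.
  parent-or-neighbour : ∀ w → ∃[ u ] (Adj G w u × Children w u)
  parent-or-neighbour w with any? (λ u → (adj G w u ≟ᵇ true) ×-dec (depth w ≟ suc (depth u)))
  ... | yes (u , wu , w-below-u) = u , wu , λ wc c≢u →
    [ id , (λ w-below-c → contradiction (parent-unique wc wu w-below-c w-below-u) c≢u) ]′ (depth-adj wc)
  ... | no no-parent = proj₁ (no-isolated w) , proj₂ (no-isolated w) , λ wc _ →
    [ id , (λ w-below-c → contradiction (_ , wc , w-below-c) no-parent) ]′ (depth-adj wc)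

  -- A common neighbour v ≢ u of w and q is a child of w, so q is w or a grandchild of w.
  deepest-unshared : ∀ {W w u q} → Deepest W w → Children w u →
                     q ∈ W → ¬ Adj G u q → SharesNeighbour G w q → w ≡ q
  deepest-unshared {w = w} {u} {q} deepest children q∈W u≁q (v , vw , vq) with v ≟ᶠ u
  ... | yes refl = contradiction vq u≁q
  ... | no v≢u with depth-adj vq
  ...   | inj₁ dq≡1+dv = contradiction (deepest q∈W) (<⇒≱ dw<dq)
    where
    dw<dq : depth w < depth q
    dw<dq = subst (depth w <_) (sym dq≡1+dv)
              (s≤s (subst (depth w ≤_) (sym (children (Adj-sym G vw) v≢u)) (n≤1+n (depth w))))
  ...   | inj₂ dv≡1+dq = parent-unique vw vq (children (Adj-sym G vw) v≢u) dv≡1+dq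

  DominatedByPacking : Subset (n G) → Set
  DominatedByPacking W = ∃[ D ] ∃[ P ] (Dominates D W × P ⊆ W × IsOpenPacking G P × ∣ D ∣ ≤ ∣ P ∣)

  empty-dominated : ∀ {W} → Empty W → DominatedByPacking W
  empty-dominated {W} empty =
    ⊥ , ⊥ , (λ w∈W → contradiction (_ , w∈W) empty) , (λ x∈⊥ → contradiction x∈⊥ ∉⊥) ,
    ∣B∣≤1⇒open-packing G {⊥} (≤-trans (≤-reflexive (∣⊥∣≡0 (n G))) z≤n) , ≤-refl

  dominated-extend : ∀ {W w u} → w ∈ W → Deepest W w → Adj G w u → Children w u →
                     DominatedByPacking (W ─ N G u) → DominatedByPacking W
  dominated-extend {W} {w} {u} w∈W deepest wu children (D , P , D-dom , P⊆W─Nu , P-packing , ∣D∣≤∣P∣) =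
    D ∪ ⁅ u ⁆ , P ∪ ⁅ w ⁆ , dominates , P∪w⊆W , packing , size
    where
    w∈Nu : w ∈ N G u
    w∈Nu = Adj⇒x∈N G (Adj-sym G wu)

    P⊆W : P ⊆ W
    P⊆W q∈P = p─q⊆p W (N G u) (P⊆W─Nu q∈P)

    P-avoids-Nu : ∀ {q} → q ∈ P → q ∉ N G u
    P-avoids-Nu q∈P = x∈p─q⇒x∉q (P⊆W─Nu q∈P)

    dominates : Dominates (D ∪ ⁅ u ⁆) W
    dominates {x} x∈W with x ∈? N G u
    ... | yes x∈Nu = u , x∈p∪q⁺ (inj₂ (x∈⁅x⁆ u)) , Adj-sym G (x∈N⇒Adj G x∈Nu)
    ... | no x∉Nu with D-dom (x∈p∧x∉q⇒x∈p─q x∈W x∉Nu)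
    ...   | d , d∈D , xd = d , x∈p∪q⁺ (inj₁ d∈D) , xd

    P∪w⊆W : P ∪ ⁅ w ⁆ ⊆ W
    P∪w⊆W y∈ with x∈p∪q⁻ P ⁅ w ⁆ y∈
    ... | inj₁ y∈P = P⊆W y∈P
    ... | inj₂ y∈w = subst (_∈ W) (sym (x∈⁅y⁆⇒x≡y w y∈w)) w∈W

    w-unshared : ∀ {x q} → x ≡ w → q ∈ P → SharesNeighbour G x q → x ≡ q
    w-unshared refl q∈P = deepest-unshared deepest children (P⊆W q∈P) (λ uq → P-avoids-Nu q∈P (Adj⇒x∈N G uq))

    packing : IsOpenPacking G (P ∪ ⁅ w ⁆)
    packing = Equivalence.from (open-packing⇔disjoint-neighbourhoods G) disjoint
      where
      P-disjoint : OpenNeighbourhoodsDisjoint G P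
      P-disjoint = Equivalence.to (open-packing⇔disjoint-neighbourhoods G) P-packing
      disjoint : OpenNeighbourhoodsDisjoint G (P ∪ ⁅ w ⁆)
      disjoint x∈ y∈ shared@(v , vx , vy) with x∈p∪q⁻ P ⁅ w ⁆ x∈ | x∈p∪q⁻ P ⁅ w ⁆ y∈
      ... | inj₁ x∈P | inj₁ y∈P = P-disjoint x∈P y∈P shared
      ... | inj₁ x∈P | inj₂ y∈w = sym (w-unshared (x∈⁅y⁆⇒x≡y w y∈w) x∈P (v , vy , vx))
      ... | inj₂ x∈w | inj₁ y∈P = w-unshared (x∈⁅y⁆⇒x≡y w x∈w) y∈P shared
      ... | inj₂ x∈w | inj₂ y∈w = trans (x∈⁅y⁆⇒x≡y w x∈w) (sym (x∈⁅y⁆⇒x≡y w y∈w))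

    w∉P : Empty (P ∩ ⁅ w ⁆)
    w∉P (x , x∈) with x∈p∩q⁻ P ⁅ w ⁆ x∈
    ... | x∈P , x∈w = P-avoids-Nu x∈P (subst (_∈ N G u) (sym (x∈⁅y⁆⇒x≡y w x∈w)) w∈Nu)

    size : ∣ D ∪ ⁅ u ⁆ ∣ ≤ ∣ P ∪ ⁅ w ⁆ ∣
    size = begin
      ∣ D ∪ ⁅ u ⁆ ∣       ≤⟨ ∣p∪q∣≤∣p∣+∣q∣ D ⁅ u ⁆ ⟩
      ∣ D ∣ + ∣ ⁅ u ⁆ ∣   ≡⟨ cong (∣ D ∣ +_) (trans (∣⁅x⁆∣≡1 u) (sym (∣⁅x⁆∣≡1 w))) ⟩
      ∣ D ∣ + ∣ ⁅ w ⁆ ∣   ≤⟨ +-monoˡ-≤ ∣ ⁅ w ⁆ ∣ ∣D∣≤∣P∣ ⟩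
      ∣ P ∣ + ∣ ⁅ w ⁆ ∣   ≡⟨ Empty[p∩q]⇒∣p∪q∣≡∣p∣+∣q∣ P ⁅ w ⁆ w∉P ⟨
      ∣ P ∪ ⁅ w ⁆ ∣       ∎
      where open ≤-Reasoning

  dominated-by-packing : ∀ W → Acc _<_ ∣ W ∣ → DominatedByPacking W
  dominated-by-packing W (acc smaller) with nonempty? W
  ... | no empty = empty-dominated empty
  ... | yes nonempty with argmax depth nonempty
  ...   | w , w∈W , deepest with parent-or-neighbour w
  ...     | u , wu , children = dominated-extend w∈W deepest wu children
    (dominated-by-packing (W ─ N G u) (smaller (p∩q≢∅⇒∣p─q∣<∣p∣ W (N G u) (w , w∈W∩Nu))))
    where
    w∈W∩Nu : w ∈ W ∩ N G u
    w∈W∩Nu = x∈p∩q⁺ (w∈W , Adj⇒x∈N G (Adj-sym G wu))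

  total-domination≤open-packing :
    ∃[ D ] ∃[ P ] (IsTotalDominating G D × IsOpenPacking G P × ∣ D ∣ ≤ ∣ P ∣)
  total-domination≤open-packing with dominated-by-packing ⊤ (<-wellFounded _)
  ... | D , P , D-dom , _ , P-packing , ∣D∣≤∣P∣ = D , P , (λ _ → D-dom ∈⊤) , P-packing , ∣D∣≤∣P∣

  ρo≡⇒γt≡ : ∀ {p} → ρo≡ G p → γt≡ G p
  ρo≡⇒γt≡ {p} ((B , B-packing , ∣B∣≡p) , maximal) with total-domination≤open-packing
  ... | D , P , D-total , P-packing , ∣D∣≤∣P∣ = (D , D-total , ∣D∣≡p) , p≤total-domination
    where
    p≤total-domination : ∀ D′ → IsTotalDominating G D′ → p ≤ ∣ D′ ∣
    p≤total-domination D′ D′-total =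
      subst (_≤ ∣ D′ ∣) ∣B∣≡p (open-packing≤total-domination G {B} B-packing D′-total)
    ∣D∣≡p : ∣ D ∣ ≡ p
    ∣D∣≡p = ≤-antisym (≤-trans ∣D∣≤∣P∣ (maximal P P-packing)) (p≤total-domination D D-total)

-- The bounds for trees

module TreeBounds (T : Graph) (tree : IsTree T) (Δ≥2 : MaxDegree≥ T 2)
                  {p l : ℕ} (ρo≡p : ρo≡ T p) (L2t≡l : L2t≡ T l) where

  private
    v₀ : Fin (n T)
    v₀ = proj₁ Δ≥2

    1<deg : 1 < ∣ N T v₀ ∣
    1<deg = proj₂ Δ≥2

    rooting : Rooting T
    rooting = tree-rooting T tree v₀

    B : Subset (n T)
    B = proj₁ (proj₁ ρo≡p)

    B-packing : IsOpenPacking T B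
    B-packing = proj₁ (proj₂ (proj₁ ρo≡p))

    B-disjoint : OpenNeighbourhoodsDisjoint T B
    B-disjoint = Equivalence.to (open-packing⇔disjoint-neighbourhoods T) B-packing

    ∣B∣≡p : ∣ B ∣ ≡ p
    ∣B∣≡p = proj₂ (proj₂ (proj₁ ρo≡p))

    S₀ : Subset (n T)
    S₀ = proj₁ (proj₁ L2t≡l)

    S₀-limited : Is2TotalLimitedPacking T S₀
    S₀-limited = proj₁ (proj₂ (proj₁ L2t≡l))

    ∣S₀∣≡l : ∣ S₀ ∣ ≡ l
    ∣S₀∣≡l = proj₂ (proj₂ (proj₁ L2t≡l))

    no-isolated : ∀ v → ∃[ u ] Adj T v u
    no-isolated with 1<∣p∣⇒∃≢ 1<deg v₀
    ... | u , u∈N , _ = connected⇒no-isolated T (proj₁ tree) (x∈N⇒Adj T u∈N)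

    γt≡p : γt≡ T p
    γt≡p = Greedy.ρo≡⇒γt≡ T rooting no-isolated ρo≡p

    D₀ : Subset (n T)
    D₀ = proj₁ (proj₁ γt≡p)

    D₀-total : IsTotalDominating T D₀
    D₀-total = proj₁ (proj₂ (proj₁ γt≡p))

    ∣D₀∣≡p : ∣ D₀ ∣ ≡ p
    ∣D₀∣≡p = proj₂ (proj₂ (proj₁ γt≡p))

    extend-bound : ∀ {E} → IsOpenPacking T E → (∀ {x} → x ∈ E → x ∉ B) → p + ∣ E ∣ ≤ l
    extend-bound {E} E-packing E-outside = subst (_≤ l) ∣B∪E∣≡p+∣E∣
      (proj₂ L2t≡l (B ∪ E) (∪-open-packing T {B} {E} B-packing E-packing))
      where
      disjoint : Empty (B ∩ E)
      disjoint (x , x∈) with x∈p∩q⁻ B E x∈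
      ... | x∈B , x∈E = E-outside x∈E x∈B
      ∣B∪E∣≡p+∣E∣ : ∣ B ∪ E ∣ ≡ p + ∣ E ∣
      ∣B∪E∣≡p+∣E∣ = trans (Empty[p∩q]⇒∣p∪q∣≡∣p∣+∣q∣ B E disjoint) (cong (_+ ∣ E ∣) ∣B∣≡p)

    one-outside : ∀ {a c} → SharesNeighbour T a c → a ≢ c →
                  ∃[ x ] (x ∉ B × colour rooting x ≡ colour rooting a)
    one-outside {a} {c} shared a≢c with a ∈? B | c ∈? B
    ... | no a∉B  | _       = a , a∉B , refl
    ... | yes _   | no c∉B  = c , c∉B , sym (shared⇒same-colour rooting shared)
    ... | yes a∈B | yes c∈B = contradiction (B-disjoint a∈B c∈B shared) a≢c

    pair-bound : ∀ {x y} → x ∉ B → y ∉ B → colour rooting x ≢ colour rooting y → p + 2 ≤ l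
    pair-bound {x} {y} x∉B y∉B colours-differ =
      subst (λ k → p + k ≤ l) (∣⁅x⁆∪⁅y⁆∣≡2 x≢y) (extend-bound (pair-open-packing T unshared) pair∉B)
      where
      x≢y : x ≢ y
      x≢y refl = colours-differ refl
      unshared : ¬ SharesNeighbour T x y
      unshared shared = colours-differ (shared⇒same-colour rooting shared)
      pair∉B : ∀ {z} → z ∈ ⁅ x ⁆ ∪ ⁅ y ⁆ → z ∉ B
      pair∉B z∈ with x∈⁅y⁆∪⁅z⁆⁻ z∈
      ... | inj₁ refl = x∉B
      ... | inj₂ refl = y∉B

    walk-bound : ∀ {a b c d} → NonBacktrackingWalk T a b c d → p + 2 ≤ l
    walk-bound (ab , bc , cd , a≢c , b≢d)
      with one-outside (_ , Adj-sym T ab , bc) a≢c | one-outside (_ , Adj-sym T bc , cd) b≢d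
    ... | x , x∉B , x~a | y , y∉B , y~b = pair-bound x∉B y∉B λ same → not-¬ same opposite
      where
      opposite : colour rooting x ≡ not (colour rooting y)
      opposite = trans x~a (trans (colour-adj rooting ab) (cong not (sym y~b)))

    single-bound : ∀ {x} → x ∉ B → p + 1 ≤ l
    single-bound {x} x∉B = subst (λ k → p + k ≤ l) (∣⁅x⁆∣≡1 x)
      (extend-bound (∣B∣≤1⇒open-packing T {⁅ x ⁆} (≤-reflexive (∣⁅x⁆∣≡1 x)))
                    (λ y∈⁅x⁆ → subst (_∉ B) (sym (x∈⁅y⁆⇒x≡y x y∈⁅x⁆)) x∉B))

  ρo+1≤L2t : p + 1 ≤ l
  ρo+1≤L2t with 1<∣p∣⇒∃≢ 1<deg v₀
  ... | y , y∈N , _ with 1<∣p∣⇒∃≢ 1<deg y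
  ...   | z , z∈N , z≢y with y ∈? B | z ∈? B
  ...     | no y∉B  | _       = single-bound y∉B
  ...     | yes _   | no z∉B  = single-bound z∉B
  ...     | yes y∈B | yes z∈B =
    contradiction (B-disjoint z∈B y∈B (v₀ , x∈N⇒Adj T z∈N , x∈N⇒Adj T y∈N)) z≢y

  L2t≤2ρo : l ≤ 2 * p
  L2t≤2ρo = begin
    l            ≡⟨ ∣S₀∣≡l ⟨
    ∣ S₀ ∣       ≤⟨ ∣X∣≤k*∣D∣ T {X = S₀} S₀-limited D₀-total ⟩
    2 * ∣ D₀ ∣   ≡⟨ cong (2 *_) ∣D₀∣≡p ⟩
    2 * p        ∎
    where open ≤-Reasoning

  ρo+1≡L2t⇒star : p + 1 ≡ l → IsStar≥3 T
  ρo+1≡L2t⇒star p+1≡l = no-walk₃⇒star T (proj₁ tree) 1<deg λ walk →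
    contradiction (+-cancelˡ-≤ p 2 1 (subst (p + 2 ≤_) (sym p+1≡l) (walk-bound walk)))
                  λ { (s≤s ()) }

  star⇒ρo+1≡L2t : IsStar≥3 T → p + 1 ≡ l
  star⇒ρo+1≡L2t star with star⇒open-packing-pair T star
  ... | B₂ , B₂-packing , ∣B₂∣≡2 = ≤-antisym ρo+1≤L2t (begin
    l        ≡⟨ ∣S₀∣≡l ⟨
    ∣ S₀ ∣   ≤⟨ star⇒∣S∣≤3 T star {S₀} S₀-limited ⟩
    2 + 1    ≤⟨ +-monoˡ-≤ 1 (subst (_≤ p) ∣B₂∣≡2 (proj₂ ρo≡p B₂ B₂-packing)) ⟩
    p + 1    ∎)
    where open ≤-Reasoning

  Tight : Set
  Tight = ∀ S D → IsL2tSet T S → IsγtSet T D →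
          (∀ s → s ∈ S → ∣ N T s ∩ D ∣ ≡ 1) × (∀ d → d ∈ D → ∣ N T d ∩ S ∣ ≡ 2)

  L2t≡2ρo⇒tight : l ≡ 2 * p → Tight
  L2t≡2ρo⇒tight l≡2p S D (S-limited , L2t≡∣S∣) (D-total , γt≡∣D∣) =
    (λ _ → proj₁ tight) , (λ _ → proj₂ tight)
    where
    2∣D∣≡∣S∣ : 2 * ∣ D ∣ ≡ ∣ S ∣
    2∣D∣≡∣S∣ = begin
      2 * ∣ D ∣   ≡⟨ cong (2 *_) (IsMinSize-unique T γt≡∣D∣ γt≡p) ⟩
      2 * p       ≡⟨ l≡2p ⟨
      l           ≡⟨ IsMaxSize-unique T L2t≡l L2t≡∣S∣ ⟩
      ∣ S ∣       ∎
      where open ≡-Reasoning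
    tight : (∀ {s} → s ∈ S → ∣ N T s ∩ D ∣ ≡ 1) × (∀ {d} → d ∈ D → ∣ N T d ∩ S ∣ ≡ 2)
    tight = k*∣D∣≤∣X∣⇒tight T {X = S} S-limited D-total (≤-reflexive 2∣D∣≡∣S∣)

  tight⇒L2t≡2ρo : Tight → l ≡ 2 * p
  tight⇒L2t≡2ρo tight with tight S₀ D₀ (S₀-limited , subst (L2t≡ T) (sym ∣S₀∣≡l) L2t≡l)
                                      (D₀-total , subst (γt≡ T) (sym ∣D₀∣≡p) γt≡p)
  ... | S-tight , D-tight = begin
    l            ≡⟨ ∣S₀∣≡l ⟨
    ∣ S₀ ∣       ≡⟨ tight⇒∣X∣≡k*∣D∣ T (S-tight _) (D-tight _) ⟩
    2 * ∣ D₀ ∣   ≡⟨ cong (2 *_) ∣D₀∣≡p ⟩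
    2 * p        ∎
    where open ≡-Reasoning

mainTheorem7 : (T : Graph) → IsTree T → MaxDegree≥ T 2 →
    (p l : ℕ) → ρo≡ T p → L2t≡ T l →
    (p + 1 ≤ l × l ≤ 2 * p)
    × ((p + 1 ≡ l) ⇔ IsStar≥3 T)
    × ((l ≡ 2 * p) ⇔
        (∀ S D → IsL2tSet T S → IsγtSet T D →
          (∀ s → s ∈ S → ∣ N T s ∩ D ∣ ≡ 1) × (∀ d → d ∈ D → ∣ N T d ∩ S ∣ ≡ 2)))
mainTheorem7 T tree Δ≥2 p l ρo≡p L2t≡l =
  (ρo+1≤L2t , L2t≤2ρo) , mk⇔ ρo+1≡L2t⇒star star⇒ρo+1≡L2t , mk⇔ L2t≡2ρo⇒tight tight⇒L2t≡2ρo
  where open TreeBounds T tree Δ≥2 ρo≡p L2t≡l
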